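{- For all integers $n\ge1$ and all $1\le j\le n$, \[N(n,j)=F_{2n-2}-F_{2j-4}F_{2(n-j)-1},\] where $N(n,j)$ is the number of Boolean permutations $w\in\mathcal B_n$ such that position $j$ is a record of $w$.
   Context: $\mathcal B_n$ is the set of Boolean permutations in $S_n$: those that can be written as a product of simple transpositions $s_i=(i\ i{+}1)$ in which no $s_i$ appears more than once. Position $j$ is a record of $w$ (in one-line notation) if there is no $k<j$ with $w(k)>w(j)$. $F_m$ is the Fibonacci sequence ($F_0=0$, $F_1=F_2=1$, $F_{m+1}=F_m+F_{m-1}$), extended to negative indices by $F_{ -m}=(-1)^{m+1}F_m$. -}

module Defs where

open import Data.Nat as ℕ using (ℕ; zero; suc; _<_; _≤_)
open import Data.Nat using (_≟_)
open import Data.Integer as ℤ using (ℤ; +_; -[1+_])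
open import Data.List using (List; []; _∷_; map; upTo; length)
open import Data.List.Membership.Propositional using (_∈_)
open import Data.List.Relation.Unary.All using (All)
open import Data.List.Relation.Unary.Unique.Propositional using (Unique)
open import Data.Product using (Σ; _×_)
open import Relation.Nullary using (¬_; yes; no)
open import Relation.Binary.PropositionalEquality using (_≡_)

fib : ℕ → ℕ
fib zero = zero
fib (suc zero) = suc zero
fib (suc (suc m)) = fib (suc m) ℕ.+ fib m

-- Extension to ℤ: F_{-k} = (-1)^{k+1} F_k.  For -[1+ m ] = -(m+1): sign (-1)^(m+2) = (-1)^m.
signPow : ℕ → ℤ
signPow zero = + 1
signPow (suc m) = ℤ.- signPow m

fibℤ : ℤ → ℤ
fibℤ (+ n) = + fib n
fibℤ (-[1+ m ]) = signPow m ℤ.* (+ fib (suc m))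

-- Simple transposition s_i (0-indexed: swaps values i and i+1) acting on ℕ.
swapAdj : ℕ → ℕ → ℕ
swapAdj i x with x ≟ i
... | yes _ = suc i
... | no _ with x ≟ suc i
...   | yes _ = i
...   | no _ = x

prodApply : List ℕ → ℕ → ℕ
prodApply [] x = x
prodApply (i ∷ is) x = swapAdj i (prodApply is x)

-- One-line notation of the product of the simple transpositions in the list,
-- as a permutation of {0,…,n-1} (values 0-indexed): [w(0), …, w(n-1)].
oneLine : ℕ → List ℕ → List ℕ
oneLine n is = map (prodApply is) (upTo n)

-- w ∈ 𝓑ₙ : w (in one-line notation) is a product of simple transpositions
-- s_i (1 ≤ i ≤ n-1, here 0 ≤ i < n-1) with no s_i appearing more than once.
IsBoolean : ℕ → List ℕ → Set
IsBoolean n w = Σ (List ℕ) λ is → Unique is × All (λ i → suc i < n) is × w ≡ oneLine n is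

-- entry at 1-indexed position p of a one-line word (0 if out of range)
at : List ℕ → ℕ → ℕ
at [] _ = zero
at (x ∷ _) (suc zero) = x
at (_ ∷ xs) (suc (suc p)) = at xs (suc p)
at (_ ∷ _) zero = zero

IsRecord : List ℕ → ℕ → Set
IsRecord w j = ¬ (Σ ℕ λ k → 1 ≤ k × k < j × at w j < at w k)

CountIs : ℕ → ℕ → ℕ → Set
CountIs n j c = Σ (List (List ℕ)) λ L →
  Unique L ×
  (∀ w → (w ∈ L → IsBoolean n w × IsRecord w j)
       × (IsBoolean n w × IsRecord w j → w ∈ L)) ×
  length L ≡ c

{-# OPTIONS --safe #-}
module Submission where

-- Since s_k commutes with every s_i
-- except s_{k−1}, which lies on at most one side of it, the permutation is v, s_k v or v s_k for a
-- Boolean permutation v of {0, …, k}, and v s_k = s_k v when v fixes k. So the Boolean permutations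
-- of {0, …, k+1} are, without repetition, those v, all s_k v, and the v s_k with v moving k: the three
-- families are told apart by the value at position k+1.
--
-- Fix a record position p ≤ k (0-indexed). Prepending s_{k+1} renames the value k+1 to k+2 without
-- changing the relative order of the values at positions ≤ p, and appending it does not touch those
-- positions. So the number c_k of permutations of {0, …, k} with a record at p satisfies
-- c_{k+2} = 2 c_{k+1} + (c_{k+1} − c_k), the last term counting those permutations of {0, …, k+1}
-- with a record at p that move k+1.
-- The sequence d ↦ F_{z+2d} satisfies the same recurrence x_{d+2} = 3 x_{d+1} − x_d, so the formula
-- follows from its cases n = j and n = j + 1, where a record at the last position means a fixed point.

open import Defs
open import Data.Bool using (true; false)
open import Data.Integer using (ℤ; +_; -[1+_]; _+_; _-_; _*_; -_)
open import Data.Integer.Properties using (+-assoc; +-identityˡ; +-comm; pos-+)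
open import Data.Integer.Tactic.RingSolver using (solve-∀)
open import Data.List using (List; []; _∷_; _++_; [_]; map; filter; length; applyUpTo; upTo)
open import Data.List.Properties
  using (filter-++; length-++; length-map; map-cong; filter-all; filter-none)
open import Data.List.Membership.Propositional using (_∈_; _∉_; find)
open import Data.List.Membership.Propositional.Properties
  using (∈-map⁺; ∈-map⁻; ∈-++⁺ˡ; ∈-++⁺ʳ; ∈-++⁻; ∈-∃++; ∈-filter⁺; ∈-filter⁻)
open import Data.List.Relation.Binary.Disjoint.Propositional using (Disjoint)
open import Data.List.Relation.Unary.All as All using (All; []; _∷_; all?)
import Data.List.Relation.Unary.All.Properties as All
open import Data.List.Relation.Unary.AllPairs as AllPairs using (AllPairs; []; _∷_)
import Data.List.Relation.Unary.AllPairs.Properties as AllPairs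
open import Data.List.Relation.Unary.Any using (here; there)
open import Data.List.Relation.Unary.Unique.Propositional using (Unique)
import Data.List.Relation.Unary.Unique.Propositional.Properties as Unique
import Data.Nat as ℕ
open import Data.Nat using (ℕ; zero; suc; _≤_; _<_; _∸_; _≟_; _≤?_; _<?_; s≤s; z≤n; allUpTo?)
open import Data.Nat.Properties
  using (≤-refl; ≤-trans; ≤-pred; ≤-antisym; <-trans; <-≤-trans; ≤-<-trans; <⇒≤; <⇒≢; >⇒≢;
         <⇒≱; ≮⇒≥; ≤∧≢⇒<; ≤∧≮⇒≡; <-irrefl; <-asym; m<n⇒m<1+n; m≤n⇒m≤1+n; n≤1+n; n<1+n;
         m≤n⇒m<n∨m≡n; m≤n+m; m∸n+n≡m; +-suc; +-cancelˡ-≡; suc-injective; 1+n≢n)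
  renaming (+-comm to ℕ-+-comm)
open import Data.List.Membership.DecPropositional _≟_ using (_∈?_)
open import Data.Product using (Σ; ∃; _×_; _,_; proj₁; proj₂)
open import Data.Sum using (_⊎_; inj₁; inj₂)
open import Function using (_∘_; id; _⇔_; mk⇔; Equivalence)
open import Relation.Nullary using (¬_; yes; no; does; contradiction)
open import Relation.Nullary.Decidable using (¬?; decidable-stable)
open import Relation.Unary using (Pred; Decidable)
open import Relation.Unary.Properties using (U?)
open import Relation.Binary.PropositionalEquality
  using (_≡_; _≢_; refl; sym; trans; cong; cong₂; subst; subst₂; _≗_; module ≡-Reasoning)

open ≡-Reasoning
open Equivalence using (to; from)

-- Simple transpositions and their products

data SwapAdjCase (i x : ℕ) : Set where
  at-i      : x ≡ i → SwapAdjCase i x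
  at-suc-i  : x ≡ suc i → SwapAdjCase i x
  elsewhere : x ≢ i → x ≢ suc i → SwapAdjCase i x

swapAdj-case : ∀ i x → SwapAdjCase i x
swapAdj-case i x with x ≟ i | x ≟ suc i
... | yes x≡i | _         = at-i x≡i
... | no _    | yes x≡1+i = at-suc-i x≡1+i
... | no x≢i  | no x≢1+i  = elsewhere x≢i x≢1+i

swapAdj-self : ∀ i → swapAdj i i ≡ suc i
swapAdj-self i with i ≟ i
... | yes _  = refl
... | no i≢i = contradiction refl i≢i

swapAdj-suc : ∀ i → swapAdj i (suc i) ≡ i
swapAdj-suc i with suc i ≟ i
... | yes 1+i≡i = contradiction 1+i≡i 1+n≢n
... | no _ with suc i ≟ suc i
...   | yes _      = refl
...   | no 1+i≢1+i = contradiction refl 1+i≢1+i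

swapAdj-other : ∀ {i x} → x ≢ i → x ≢ suc i → swapAdj i x ≡ x
swapAdj-other {i} {x} x≢i x≢1+i with x ≟ i
... | yes x≡i = contradiction x≡i x≢i
... | no _ with x ≟ suc i
...   | yes x≡1+i = contradiction x≡1+i x≢1+i
...   | no _      = refl

swapAdj-involutive : ∀ i x → swapAdj i (swapAdj i x) ≡ x
swapAdj-involutive i x with swapAdj-case i x
... | at-i refl           rewrite swapAdj-self i = swapAdj-suc i
... | at-suc-i refl       rewrite swapAdj-suc i = swapAdj-self i
... | elsewhere x≢i x≢1+i rewrite swapAdj-other x≢i x≢1+i = swapAdj-other x≢i x≢1+i

swapAdj-injective : ∀ i {x y} → swapAdj i x ≡ swapAdj i y → x ≡ y
swapAdj-injective i {x} {y} eq = begin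
  x                       ≡⟨ swapAdj-involutive i x ⟨
  swapAdj i (swapAdj i x) ≡⟨ cong (swapAdj i) eq ⟩
  swapAdj i (swapAdj i y) ≡⟨ swapAdj-involutive i y ⟩
  y                       ∎

swapAdj-< : ∀ {i x} → x < i → swapAdj i x ≡ x
swapAdj-< x<i = swapAdj-other (<⇒≢ x<i) (<⇒≢ (m<n⇒m<1+n x<i))

swapAdj-> : ∀ {i x} → suc i < x → swapAdj i x ≡ x
swapAdj-> 1+i<x = swapAdj-other (>⇒≢ (<-trans (n<1+n _) 1+i<x)) (>⇒≢ 1+i<x)

swapAdj-bounded : ∀ {i N x} → suc i < N → x < N → swapAdj i x < N
swapAdj-bounded {i} {N} {x} 1+i<N x<N with swapAdj-case i x
... | at-i refl           rewrite swapAdj-self i = 1+i<N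
... | at-suc-i refl       rewrite swapAdj-suc i = <-trans (n<1+n i) 1+i<N
... | elsewhere x≢i x≢1+i rewrite swapAdj-other x≢i x≢1+i = x<N

swapAdj-≥ : ∀ {k y} → k ≤ y → k ≤ swapAdj k y
swapAdj-≥ {k} {y} k≤y with swapAdj-case k y
... | at-i refl           rewrite swapAdj-self k = n≤1+n k
... | at-suc-i refl       rewrite swapAdj-suc k = ≤-refl
... | elsewhere y≢k y≢1+k rewrite swapAdj-other y≢k y≢1+k = k≤y

-- Below k, s_k acts trivially and s_i stays below k; from k on, s_i acts trivially and s_k stays there.
swapAdj-comm : ∀ {i k} → suc i < k → ∀ x → swapAdj k (swapAdj i x) ≡ swapAdj i (swapAdj k x)
swapAdj-comm {i} {k} 1+i<k x with x <? k
... | yes x<k = trans (swapAdj-< (swapAdj-bounded 1+i<k x<k)) (cong (swapAdj i) (sym (swapAdj-< x<k)))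
... | no x≮k  = trans (cong (swapAdj k) (swapAdj-> (<-≤-trans 1+i<k (≮⇒≥ x≮k))))
                      (sym (swapAdj-> (<-≤-trans 1+i<k (swapAdj-≥ (≮⇒≥ x≮k)))))

swapAdj-≤⇔ : ∀ {k a b} → a ≤ k → b ≤ k → (swapAdj k a ≤ swapAdj k b ⇔ a ≤ b)
swapAdj-≤⇔ {k} {a} {b} a≤k b≤k with m≤n⇒m<n∨m≡n a≤k | m≤n⇒m<n∨m≡n b≤k
... | inj₁ a<k  | inj₁ b<k  rewrite swapAdj-< a<k | swapAdj-< b<k = mk⇔ id id
... | inj₁ a<k  | inj₂ refl rewrite swapAdj-< a<k | swapAdj-self k =
  mk⇔ (λ _ → <⇒≤ a<k) (λ _ → <⇒≤ (m<n⇒m<1+n a<k))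
... | inj₂ refl | inj₁ b<k  rewrite swapAdj-self k | swapAdj-< b<k =
  mk⇔ (λ k<b → contradiction k<b (<-asym b<k)) (λ k≤b → contradiction k≤b (<⇒≱ b<k))
... | inj₂ refl | inj₂ refl = mk⇔ (λ _ → ≤-refl) (λ _ → ≤-refl)

Bounded : ℕ → List ℕ → Set
Bounded N = All (λ i → suc i < N)

prodApply-++ : ∀ us vs x → prodApply (us ++ vs) x ≡ prodApply us (prodApply vs x)
prodApply-++ []       vs x = refl
prodApply-++ (i ∷ us) vs x = cong (swapAdj i) (prodApply-++ us vs x)

prodApply-fixes : ∀ {N u x} → Bounded N u → N ≤ x → prodApply u x ≡ x
prodApply-fixes []            N≤x = refl
prodApply-fixes (1+i<N ∷ bnd) N≤x =
  trans (cong (swapAdj _) (prodApply-fixes bnd N≤x)) (swapAdj-> (<-≤-trans 1+i<N N≤x))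

prodApply-bounded : ∀ {N u x} → Bounded N u → x < N → prodApply u x < N
prodApply-bounded []            x<N = x<N
prodApply-bounded (1+i<N ∷ bnd) x<N = swapAdj-bounded 1+i<N (prodApply-bounded bnd x<N)

prodApply-surjective : ∀ {N u y} → Bounded N u → y < N → ∃ λ x → x < N × prodApply u x ≡ y
prodApply-surjective [] y<N = _ , y<N , refl
prodApply-surjective {u = i ∷ u} {y} (1+i<N ∷ bnd) y<N
  with x , x<N , ux≡ ← prodApply-surjective bnd (swapAdj-bounded 1+i<N y<N)
  = x , x<N , trans (cong (swapAdj i) ux≡) (swapAdj-involutive i y)

prodApply-injective : ∀ u {x y} → prodApply u x ≡ prodApply u y → x ≡ y
prodApply-injective []      eq = eq
prodApply-injective (i ∷ u) eq = prodApply-injective u (swapAdj-injective i eq)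

prodApply-swapAdj-comm : ∀ {k u} → Bounded k u →
  ∀ x → swapAdj k (prodApply u x) ≡ prodApply u (swapAdj k x)
prodApply-swapAdj-comm []                        x = refl
prodApply-swapAdj-comm {u = i ∷ u} (1+i<k ∷ bnd) x =
  trans (swapAdj-comm 1+i<k (prodApply u x)) (cong (swapAdj i) (prodApply-swapAdj-comm bnd x))

prodApply-swapAdj-comm-fixed : ∀ {k u} → Bounded (suc k) u → prodApply u k ≡ k →
  ∀ x → prodApply u (swapAdj k x) ≡ swapAdj k (prodApply u x)
prodApply-swapAdj-comm-fixed {k} {u} bnd uk≡k x with swapAdj-case k x
... | at-i refl
  rewrite swapAdj-self k | uk≡k | prodApply-fixes bnd (≤-refl {suc k}) = sym (swapAdj-self k)
... | at-suc-i refl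
  rewrite swapAdj-suc k | uk≡k | prodApply-fixes bnd (≤-refl {suc k}) = sym (swapAdj-suc k)
... | elsewhere x≢k x≢1+k =
  trans (cong (prodApply u) (swapAdj-other x≢k x≢1+k)) (sym (swapAdj-other ux≢k ux≢1+k))
  where
  ux≢k : prodApply u x ≢ k
  ux≢k eq = x≢k (prodApply-injective u (trans eq (sym uk≡k)))
  ux≢1+k : prodApply u x ≢ suc k
  ux≢1+k eq = x≢1+k (prodApply-injective u (trans eq (sym (prodApply-fixes bnd ≤-refl))))

commute-to-front : ∀ {k} A B → Bounded k A → prodApply (A ++ k ∷ B) ≗ swapAdj k ∘ prodApply (A ++ B)
commute-to-front {k} A B A<k x = begin
  prodApply (A ++ k ∷ B) x                ≡⟨ prodApply-++ A (k ∷ B) x ⟩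
  prodApply A (swapAdj k (prodApply B x)) ≡⟨ prodApply-swapAdj-comm A<k (prodApply B x) ⟨
  swapAdj k (prodApply A (prodApply B x)) ≡⟨ cong (swapAdj k) (prodApply-++ A B x) ⟨
  swapAdj k (prodApply (A ++ B) x)        ∎

commute-to-back : ∀ {k} A B → Bounded k B → prodApply (A ++ k ∷ B) ≗ prodApply (A ++ B) ∘ swapAdj k
commute-to-back {k} A B B<k x = begin
  prodApply (A ++ k ∷ B) x                ≡⟨ prodApply-++ A (k ∷ B) x ⟩
  prodApply A (swapAdj k (prodApply B x)) ≡⟨ cong (prodApply A) (prodApply-swapAdj-comm B<k x) ⟩
  prodApply A (prodApply B (swapAdj k x)) ≡⟨ prodApply-++ A B (swapAdj k x) ⟨
  prodApply (A ++ B) (swapAdj k x)        ∎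

∉-Bounded : ∀ {k u} → Bounded (suc k) u → k ∉ u
∉-Bounded bnd k∈u = <-irrefl refl (All.lookup bnd k∈u)

Bounded-shrink : ∀ {N u} → Bounded (suc N) u → (∀ {i} → i ∈ u → suc i ≢ N) → Bounded N u
Bounded-shrink bnd avoids = All.tabulate λ i∈u → ≤∧≢⇒< (≤-pred (All.lookup bnd i∈u)) (avoids i∈u)

Bounded-drop : ∀ {k u} → Bounded (suc (suc k)) u → k ∉ u → Bounded (suc k) u
Bounded-drop bnd k∉u =
  Bounded-shrink bnd λ i∈u 1+i≡1+k → k∉u (subst (_∈ _) (suc-injective 1+i≡1+k) i∈u)

-- `Bounded k A` says that A avoids s_{k−1}, which cannot occur in both of two disjoint words.
Bounded-one-side : ∀ {k A B} → Disjoint A B → Bounded (suc k) A → Bounded (suc k) B →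
  Bounded k A ⊎ Bounded k B
Bounded-one-side {k} {A} {B} A#B bndA bndB with all? (λ i → suc i <? k) B
... | yes B<k = inj₂ B<k
... | no B≮k with i , i∈B , 1+i≮k ← find (All.¬All⇒Any¬ (λ i → suc i <? k) B B≮k) =
  inj₁ (Bounded-shrink bndA λ a∈A 1+a≡k → A#B (a∈A , subst (_∈ B) (i≡a 1+a≡k) i∈B))
  where
  i≡a : ∀ {a} → suc a ≡ k → i ≡ a
  i≡a 1+a≡k = suc-injective (trans (≤∧≮⇒≡ (≤-pred (All.lookup bndB i∈B)) 1+i≮k) (sym 1+a≡k))

Unique-++-∷⁻ : ∀ {A : Set} (xs : List A) {y ys} → Unique (xs ++ y ∷ ys) →
  y ∉ xs ++ ys × Unique (xs ++ ys) × Disjoint xs ys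
Unique-++-∷⁻ []       (y∉ys ∷ uniq) = All.All¬⇒¬Any y∉ys , uniq , λ { (() , _) }
Unique-++-∷⁻ (x ∷ xs) (x∉ ∷ uniq)
  with y∉ , uniq′ , xs#ys ← Unique-++-∷⁻ xs uniq
  with x∉xs , (x≢y ∷ x∉ys) ← All.++⁻ xs x∉ =
  (λ { (here y≡x) → x≢y (sym y≡x) ; (there y∈) → y∉ y∈ }) ,
  (All.++⁺ x∉xs x∉ys ∷ uniq′) ,
  (λ { (here refl , v∈ys) → All.lookup x∉ys v∈ys refl ; (there v∈xs , v∈ys) → xs#ys (v∈xs , v∈ys) })

All-++-∷⁻ : ∀ {A : Set} {ℓ} {P : Pred A ℓ} xs {y ys} → All P (xs ++ y ∷ ys) → All P (xs ++ ys)
All-++-∷⁻ xs ps with pxs , (_ ∷ pys) ← All.++⁻ xs ps = All.++⁺ pxs pys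

at-map-applyUpTo : ∀ (f g : ℕ → ℕ) {N x} → x < N → at (map f (applyUpTo g N)) (suc x) ≡ f (g x)
at-map-applyUpTo f g {suc N} {zero}  _         = refl
at-map-applyUpTo f g {suc N} {suc x} (s≤s x<N) = at-map-applyUpTo f (g ∘ suc) x<N

at-oneLine : ∀ N u {x} → x < N → at (oneLine N u) (suc x) ≡ prodApply u x
at-oneLine N u = at-map-applyUpTo (prodApply u) id

AgreeBelow : ℕ → (ℕ → ℕ) → (ℕ → ℕ) → Set
AgreeBelow N f g = ∀ {x} → x < N → f x ≡ g x

oneLine-agree : ∀ {N u v} → oneLine N u ≡ oneLine N v → AgreeBelow N (prodApply u) (prodApply v)
oneLine-agree {N} {u} {v} eq {x} x<N = begin
  prodApply u x            ≡⟨ at-oneLine N u x<N ⟨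
  at (oneLine N u) (suc x) ≡⟨ cong (λ w → at w (suc x)) eq ⟩
  at (oneLine N v) (suc x) ≡⟨ at-oneLine N v x<N ⟩
  prodApply v x            ∎

-- Canonical words

Moves : ℕ → List ℕ → Set
Moves k u = prodApply u k ≢ k

moves? : ∀ k → Decidable (Moves k)
moves? k u = ¬? (prodApply u k ≟ k)

extend : ℕ → List (List ℕ) → List (List ℕ)
extend k ws = map (k ∷_) ws ++ map (_++ [ k ]) (filter (moves? k) ws)

words : ℕ → List (List ℕ)
words zero    = [ [] ]
words (suc k) = words k ++ extend k (words k)

prepend∈ : ∀ {k u} → u ∈ words k → k ∷ u ∈ words (suc k)
prepend∈ {k} u∈ = ∈-++⁺ʳ (words k) (∈-++⁺ˡ (∈-map⁺ (k ∷_) u∈))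

append∈ : ∀ {k u} → u ∈ words k → Moves k u → u ++ [ k ] ∈ words (suc k)
append∈ {k} u∈ moves = ∈-++⁺ʳ (words k)
  (∈-++⁺ʳ (map (k ∷_) (words k)) (∈-map⁺ (_++ [ k ]) (∈-filter⁺ (moves? k) u∈ moves)))

words-sound : ∀ {k u} → u ∈ words k → Unique u × Bounded (suc k) u
words-sound {zero} (here refl) = [] , []
words-sound {suc k} u∈ with ∈-++⁻ (words k) u∈
... | inj₁ u∈old with uniq , bnd ← words-sound u∈old = uniq , All.map m<n⇒m<1+n bnd
... | inj₂ u∈new with ∈-++⁻ (map (k ∷_) (words k)) u∈new
...   | inj₁ u∈pre
  with v , v∈ , refl ← ∈-map⁻ (k ∷_) u∈pre
  with uniq , bnd ← words-sound v∈ =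
  (All.¬Any⇒All¬ v (∉-Bounded bnd) ∷ uniq) , (n<1+n (suc k) ∷ All.map m<n⇒m<1+n bnd)
...   | inj₂ u∈app
  with v , v∈f , refl ← ∈-map⁻ (_++ [ k ]) u∈app
  with uniq , bnd ← words-sound (proj₁ (∈-filter⁻ (moves? k) v∈f)) =
  Unique.++⁺ uniq ([] ∷ []) (λ { (k∈v , here refl) → ∉-Bounded bnd k∈v }) ,
  All.++⁺ (All.map m<n⇒m<1+n bnd) (n<1+n (suc k) ∷ [])

words-bounded : ∀ {k u} → u ∈ words k → Bounded (suc k) u
words-bounded = proj₂ ∘ words-sound

Represented : ℕ → List ℕ → Set
Represented k is = ∃ λ u → u ∈ words k × prodApply is ≗ prodApply u

append-represented : ∀ {k u} → u ∈ words k →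
  ∃ λ w → w ∈ words (suc k) × prodApply w ≗ prodApply u ∘ swapAdj k
append-represented {k} {u} u∈ with moves? k u
... | yes moves = u ++ [ k ] , append∈ u∈ moves , prodApply-++ u [ k ]
... | no fixes  = k ∷ u , prepend∈ u∈ ,
  sym ∘ prodApply-swapAdj-comm-fixed (words-bounded u∈) (decidable-stable (prodApply u k ≟ k) fixes)

words-complete : ∀ k {is} → Unique is → Bounded (suc k) is → Represented k is
words-complete zero {[]}    _ _            = [] , here refl , λ _ → refl
words-complete zero {_ ∷ _} _ (s≤s () ∷ _)
words-complete (suc k) {is} uniq bnd with k ∈? is
... | no k∉is with u , u∈ , is≗u ← words-complete k uniq (Bounded-drop bnd k∉is) =
  u , ∈-++⁺ˡ u∈ , is≗u
... | yes k∈is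
  with A , B , refl ← ∈-∃++ k∈is
  with k∉AB , uniqAB , A#B ← Unique-++-∷⁻ A uniq
  with bndAB ← Bounded-drop (All-++-∷⁻ A bnd) k∉AB
  with u , u∈ , AB≗u ← words-complete k uniqAB bndAB
  with Bounded-one-side A#B (All.++⁻ˡ A bndAB) (All.++⁻ʳ A bndAB)
... | inj₁ A<k =
  k ∷ u , prepend∈ u∈ , λ x → trans (commute-to-front A B A<k x) (cong (swapAdj k) (AB≗u x))
... | inj₂ B<k with w , w∈ , w≗ ← append-represented u∈ =
  w , w∈ , λ x → trans (commute-to-back A B B<k x) (trans (AB≗u (swapAdj k x)) (sym (w≗ x)))

prepend-top : ∀ {k u} → Bounded (suc k) u → prodApply (k ∷ u) (suc k) ≡ k
prepend-top {k} bnd = trans (cong (swapAdj k) (prodApply-fixes bnd ≤-refl)) (swapAdj-suc k)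

append-top : ∀ {k u} → Bounded (suc k) u → Moves k u → prodApply (u ++ [ k ]) (suc k) < k
append-top {k} {u} bnd moves =
  subst (_< k) (sym top≡uk) (≤∧≢⇒< (≤-pred (prodApply-bounded bnd (n<1+n k))) moves)
  where
  top≡uk : prodApply (u ++ [ k ]) (suc k) ≡ prodApply u k
  top≡uk = trans (prodApply-++ u [ k ] (suc k)) (cong (prodApply u) (swapAdj-suc k))

words-fix : ∀ k → All (λ u → prodApply u (suc k) ≡ suc k) (words k)
words-fix k = All.tabulate λ u∈ → prodApply-fixes (words-bounded u∈) ≤-refl

extend-moves : ∀ k → All (Moves (suc k)) (extend k (words k))
extend-moves k = All.++⁺
  (All.map⁺ (All.tabulate λ u∈ top≡1+k → 1+n≢n (trans (sym top≡1+k) (prepend-top (words-bounded u∈)))))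
  (All.map⁺ (All.tabulate λ u∈f → let u∈ , moves = ∈-filter⁻ (moves? k) u∈f in
    <⇒≢ (m<n⇒m<1+n (append-top (words-bounded u∈) moves))))

Distinct : ℕ → List ℕ → List ℕ → Set
Distinct N u v = ¬ AgreeBelow N (prodApply u) (prodApply v)

Distinct-weaken : ∀ {N u v} → Distinct N u v → Distinct (suc N) u v
Distinct-weaken distinct agree = distinct λ x<N → agree (m<n⇒m<1+n x<N)

Distinct-prepend : ∀ {N k u v} → Distinct N u v → Distinct N (k ∷ u) (k ∷ v)
Distinct-prepend {k = k} distinct agree = distinct λ x<N → swapAdj-injective k (agree x<N)

Distinct-append : ∀ {k u v} → Distinct (suc k) u v → Distinct (suc (suc k)) (u ++ [ k ]) (v ++ [ k ])
Distinct-append {k} {u} {v} distinct agree = distinct λ {x} x<1+k → begin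
  prodApply u x                         ≡⟨ cong (prodApply u) (swapAdj-involutive k x) ⟨
  prodApply u (swapAdj k (swapAdj k x)) ≡⟨ prodApply-++ u [ k ] (swapAdj k x) ⟨
  prodApply (u ++ [ k ]) (swapAdj k x)  ≡⟨ agree (swapAdj-bounded ≤-refl (m<n⇒m<1+n x<1+k)) ⟩
  prodApply (v ++ [ k ]) (swapAdj k x)  ≡⟨ prodApply-++ v [ k ] (swapAdj k x) ⟩
  prodApply v (swapAdj k (swapAdj k x)) ≡⟨ cong (prodApply v) (swapAdj-involutive k x) ⟩
  prodApply v x                         ∎

words-distinct : ∀ k → AllPairs (Distinct (suc k)) (words k)
words-distinct zero    = [] ∷ []
words-distinct (suc k) =
  AllPairs.++⁺ old (AllPairs.++⁺ prepended appended prepended#appended) old#new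
  where
  ih : AllPairs (Distinct (suc k)) (words k)
  ih = words-distinct k
  top : ℕ
  top = suc k
  old : AllPairs (Distinct (suc (suc k))) (words k)
  old = AllPairs.map (λ {u} {v} → Distinct-weaken {u = u} {v}) ih
  prepended : AllPairs (Distinct (suc (suc k))) (map (k ∷_) (words k))
  prepended = AllPairs.map⁺
    (AllPairs.map (λ {u} {v} → Distinct-prepend {u = u} {v} ∘ Distinct-weaken {u = u} {v}) ih)
  appended : AllPairs (Distinct (suc (suc k))) (map (_++ [ k ]) (filter (moves? k) (words k)))
  appended = AllPairs.map⁺
    (AllPairs.filter⁺ (moves? k) (AllPairs.map (λ {u} {v} → Distinct-append {u = u} {v}) ih))
  old#new : All (λ u → All (Distinct (suc (suc k)) u) (extend k (words k))) (words k)
  old#new = All.map (λ u-fixes → All.map (λ v-moves agree → v-moves (trans (sym (agree (n<1+n top))) u-fixes))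
                                         (extend-moves k))
                    (words-fix k)
  prepended#appended : All (λ u → All (Distinct (suc (suc k)) u) (map (_++ [ k ]) (filter (moves? k) (words k))))
                           (map (k ∷_) (words k))
  prepended#appended = All.map⁺ (All.tabulate λ u∈ → All.map⁺ (All.tabulate λ v∈f agree →
    let v∈ , moves = ∈-filter⁻ (moves? k) v∈f in
    <-irrefl (trans (sym (agree (n<1+n top))) (prepend-top (words-bounded u∈)))
             (append-top (words-bounded v∈) moves)))

-- Records

RecordAt : (ℕ → ℕ) → ℕ → Set
RecordAt f p = ∀ {q} → q < p → f q ≤ f p

recordAt? : ∀ p → Decidable (λ u → RecordAt (prodApply u) p)
recordAt? p u = allUpTo? (λ q → prodApply u q ≤? prodApply u p) p

IsRecord⇔RecordAt : ∀ {N u p} → p < N → IsRecord (oneLine N u) (suc p) ⇔ RecordAt (prodApply u) p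
IsRecord⇔RecordAt {N} {u} {p} p<N = mk⇔ ⇒RecordAt RecordAt⇒
  where
  entry : ∀ {q} → q ≤ p → at (oneLine N u) (suc q) ≡ prodApply u q
  entry q≤p = at-oneLine N u (≤-<-trans q≤p p<N)
  ⇒RecordAt : IsRecord (oneLine N u) (suc p) → RecordAt (prodApply u) p
  ⇒RecordAt noLarger {q} q<p = ≮⇒≥ λ up<uq →
    noLarger (suc q , s≤s z≤n , s≤s q<p , subst₂ _<_ (sym (entry ≤-refl)) (sym (entry (<⇒≤ q<p))) up<uq)
  RecordAt⇒ : RecordAt (prodApply u) p → IsRecord (oneLine N u) (suc p)
  RecordAt⇒ largest (zero , () , _)
  RecordAt⇒ largest (suc q , _ , s≤s q<p , wp<wq) =
    <⇒≱ (subst₂ _<_ (entry ≤-refl) (entry (<⇒≤ q<p)) wp<wq) (largest q<p)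

RecordAt-cong : ∀ {f g p} → (∀ {q} → q ≤ p → f q ≡ g q) → RecordAt f p → RecordAt g p
RecordAt-cong f≡g largest q<p = subst₂ _≤_ (f≡g (<⇒≤ q<p)) (f≡g ≤-refl) (largest q<p)

RecordAt-swapAdj : ∀ {f k p} → (∀ {q} → q ≤ p → f q ≤ k) →
  RecordAt (swapAdj k ∘ f) p ⇔ RecordAt f p
RecordAt-swapAdj {f} {k} {p} f≤k =
  mk⇔ (λ largest {q} q<p → to (order q<p) (largest q<p)) (λ largest {q} q<p → from (order q<p) (largest q<p))
  where
  order : ∀ {q} → q < p → swapAdj k (f q) ≤ swapAdj k (f p) ⇔ f q ≤ f p
  order q<p = swapAdj-≤⇔ (f≤k (<⇒≤ q<p)) (f≤k ≤-refl)

RecordAt-append : ∀ {u k p} → p < k → RecordAt (prodApply (u ++ [ k ])) p ⇔ RecordAt (prodApply u) p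
RecordAt-append {u} {k} {p} p<k = mk⇔ (RecordAt-cong same) (RecordAt-cong (sym ∘ same))
  where
  same : ∀ {q} → q ≤ p → prodApply (u ++ [ k ]) q ≡ prodApply u q
  same q≤p = trans (prodApply-++ u [ k ] _) (cong (prodApply u) (swapAdj-< (≤-<-trans q≤p p<k)))

RecordAt-last : ∀ {k u} → Bounded (suc k) u → RecordAt (prodApply u) k ⇔ (¬ Moves k u)
RecordAt-last {k} {u} bnd = mk⇔ ⇒fixes fixes⇒
  where
  uk≤k : prodApply u k ≤ k
  uk≤k = ≤-pred (prodApply-bounded bnd (n<1+n k))
  ⇒fixes : RecordAt (prodApply u) k → ¬ Moves k u
  ⇒fixes largest moves with q , q<1+k , uq≡k ← prodApply-surjective bnd (n<1+n k) =
    moves (≤-antisym uk≤k (subst (_≤ prodApply u k) uq≡k (largest q<k)))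
    where
    q<k : q < k
    q<k = ≤∧≢⇒< (≤-pred q<1+k) λ { refl → moves uq≡k }
  fixes⇒ : ¬ Moves k u → RecordAt (prodApply u) k
  fixes⇒ fixes q<k = subst (prodApply u _ ≤_) (sym (decidable-stable (prodApply u k ≟ k) fixes))
                           (≤-pred (prodApply-bounded bnd (m<n⇒m<1+n q<k)))

RecordAt-append-last : ∀ {k u} → Bounded (suc k) u → RecordAt (prodApply (u ++ [ k ])) k
RecordAt-append-last {k} {u} bnd {q} q<k
  rewrite prodApply-++ u [ k ] q | prodApply-++ u [ k ] k | swapAdj-< q<k | swapAdj-self k
        | prodApply-fixes bnd (≤-refl {suc k})
  = <⇒≤ (prodApply-bounded bnd (m<n⇒m<1+n q<k))

count : ∀ {A : Set} {ℓ} {P : Pred A ℓ} → Decidable P → List A → ℕ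
count P? xs = length (filter P? xs)

module _ {A : Set} {ℓ} {P : Pred A ℓ} (P? : Decidable P) where

  count-++ : ∀ xs ys → count P? (xs ++ ys) ≡ count P? xs ℕ.+ count P? ys
  count-++ xs ys = trans (cong length (filter-++ P? xs ys)) (length-++ (filter P? xs))

  count-map : ∀ {B : Set} (f : B → A) xs → count P? (map f xs) ≡ count (P? ∘ f) xs
  count-map f []       = refl
  count-map f (x ∷ xs) with does (P? (f x))
  ... | true  = cong suc (count-map f xs)
  ... | false = count-map f xs

  count-cong : ∀ {ℓ′} {Q : Pred A ℓ′} (Q? : Decidable Q) {xs} →
    (∀ {x} → x ∈ xs → P x ⇔ Q x) → count P? xs ≡ count Q? xs
  count-cong Q? {[]}     P⇔Q = refl
  count-cong Q? {x ∷ xs} P⇔Q with P? x | Q? x | count-cong Q? {xs} (P⇔Q ∘ there)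
  ... | yes _  | yes _  | rest = cong suc rest
  ... | no _   | no _   | rest = rest
  ... | yes px | no ¬qx | _    = contradiction (to (P⇔Q (here refl)) px) ¬qx
  ... | no ¬px | yes qx | _    = contradiction (from (P⇔Q (here refl)) qx) ¬px

  count-complement : ∀ xs → count P? xs ℕ.+ count (¬? ∘ P?) xs ≡ length xs
  count-complement []       = refl
  count-complement (x ∷ xs) with P? x
  ... | yes _ = cong suc (count-complement xs)
  ... | no _  = trans (+-suc _ _) (cong suc (count-complement xs))

  count-all : ∀ {xs} → All P xs → count P? xs ≡ length xs
  count-all ps = cong length (filter-all P? ps)

count-length : ∀ {A : Set} (xs : List A) → count U? xs ≡ length xs
count-length xs = count-all U? (All.universal-U xs)

module _ {ℓ} {P : Pred (List ℕ) ℓ} (P? : Decidable P) where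

  count-words-suc : ∀ k → count P? (words (suc k)) ≡
    count P? (words k) ℕ.+
      (count (P? ∘ (k ∷_)) (words k) ℕ.+ count (P? ∘ (_++ [ k ])) (filter (moves? k) (words k)))
  count-words-suc k = begin
    count P? (words k ++ extend k (words k))
      ≡⟨ count-++ P? (words k) (extend k (words k)) ⟩
    count P? (words k) ℕ.+ count P? (extend k (words k))
      ≡⟨ cong (count P? (words k) ℕ.+_) (count-++ P? (map (k ∷_) (words k)) _) ⟩
    count P? (words k) ℕ.+ (count P? (map (k ∷_) (words k)) ℕ.+ count P? (map (_++ [ k ]) moving))
      ≡⟨ cong (count P? (words k) ℕ.+_) (cong₂ ℕ._+_ (count-map P? (k ∷_) (words k))
                                                      (count-map P? (_++ [ k ]) moving)) ⟩
    count P? (words k) ℕ.+ (count (P? ∘ (k ∷_)) (words k) ℕ.+ count (P? ∘ (_++ [ k ])) moving) ∎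
    where
    moving : List (List ℕ)
    moving = filter (moves? k) (words k)

  count-words-moves : ∀ k →
    count P? (words (suc k)) ≡ count P? (words k) ℕ.+ count P? (filter (moves? (suc k)) (words (suc k)))
  count-words-moves k = begin
    count P? (words k ++ extend k (words k))
      ≡⟨ count-++ P? (words k) _ ⟩
    count P? (words k) ℕ.+ count P? (extend k (words k))
      ≡⟨ cong (λ ws → count P? (words k) ℕ.+ count P? ws) moving ⟨
    count P? (words k) ℕ.+ count P? (filter (moves? (suc k)) (words (suc k)))
      ∎
    where
    moving : filter (moves? (suc k)) (words (suc k)) ≡ extend k (words k)
    moving = trans (filter-++ (moves? (suc k)) (words k) _)
      (cong₂ _++_ (filter-none (moves? (suc k)) (All.map (λ fixes moves → moves fixes) (words-fix k)))
                  (filter-all (moves? (suc k)) (extend-moves k)))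

  count-words-recurrence : ∀ k →
    (∀ {u} → u ∈ words (suc k) → (P (suc k ∷ u) ⇔ P u) × (P (u ++ [ suc k ]) ⇔ P u)) →
    + count P? (words (suc (suc k))) ≡ + 3 * + count P? (words (suc k)) - + count P? (words k)
  count-words-recurrence k invariant =
    arith (trans (count-words-suc (suc k))
                 (cong (count P? (words (suc k)) ℕ.+_) (cong₂ ℕ._+_ prepended appended)))
          (count-words-moves k)
    where
    moving : List (List ℕ)
    moving = filter (moves? (suc k)) (words (suc k))
    prepended : count (P? ∘ (suc k ∷_)) (words (suc k)) ≡ count P? (words (suc k))
    prepended = count-cong (P? ∘ (suc k ∷_)) P? (proj₁ ∘ invariant)
    appended : count (P? ∘ (_++ [ suc k ])) moving ≡ count P? moving
    appended = count-cong (P? ∘ (_++ [ suc k ])) P?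
      (proj₂ ∘ invariant ∘ proj₁ ∘ ∈-filter⁻ (moves? (suc k)))
    arith : ∀ {c a b r} → c ≡ a ℕ.+ (a ℕ.+ r) → a ≡ b ℕ.+ r → + c ≡ + 3 * + a - + b
    arith {b = b} {r} refl refl = identity (+ b) (+ r)
      where
      identity : ∀ b r → (b + r) + ((b + r) + r) ≡ + 3 * (b + r) - b
      identity = solve-∀

lastRecords+moves : ∀ k → count (moves? k) (words k) ℕ.+ count (recordAt? k) (words k) ≡ length (words k)
lastRecords+moves k =
  trans (cong (count (moves? k) (words k) ℕ.+_)
              (count-cong (recordAt? k) (¬? ∘ moves? k) (λ u∈ → RecordAt-last (words-bounded u∈))))
        (count-complement (moves? k) (words k))

lastRecords-suc : ∀ k → count (recordAt? (suc k)) (words (suc k)) ≡ length (words k)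
lastRecords-suc k = +-cancelˡ-≡ (count M (words (suc k))) _ _ (begin
  count M (words (suc k)) ℕ.+ count (recordAt? (suc k)) (words (suc k)) ≡⟨ lastRecords+moves (suc k) ⟩
  length (words (suc k))                                                ≡⟨ count-length (words (suc k)) ⟨
  count U? (words (suc k))                                              ≡⟨ count-words-moves U? k ⟩
  count U? (words k) ℕ.+ count U? (filter M (words (suc k)))
    ≡⟨ cong₂ ℕ._+_ (count-length (words k)) (count-length (filter M (words (suc k)))) ⟩
  length (words k) ℕ.+ count M (words (suc k))                          ≡⟨ ℕ-+-comm (length (words k)) _ ⟩
  count M (words (suc k)) ℕ.+ length (words k)                          ∎)
  where
  M : Decidable (Moves (suc k))
  M = moves? (suc k)

nextRecords : ∀ p → count (recordAt? p) (words (suc p)) ≡ count (recordAt? p) (words p) ℕ.+ length (words p)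
nextRecords p = begin
  count R (words (suc p))
    ≡⟨ count-words-suc R p ⟩
  last ℕ.+ (count (R ∘ (p ∷_)) (words p) ℕ.+ count (R ∘ (_++ [ p ])) (filter (moves? p) (words p)))
    ≡⟨ cong (last ℕ.+_) (cong₂ ℕ._+_ prepended appended) ⟩
  last ℕ.+ (last ℕ.+ count (moves? p) (words p))
    ≡⟨ cong (last ℕ.+_) (trans (ℕ-+-comm last _) (lastRecords+moves p)) ⟩
  last ℕ.+ length (words p)
    ∎
  where
  R : Decidable (λ u → RecordAt (prodApply u) p)
  R = recordAt? p
  last : ℕ
  last = count R (words p)
  prepended : count (R ∘ (p ∷_)) (words p) ≡ last
  prepended = count-cong (R ∘ (p ∷_)) R λ u∈ →
    RecordAt-swapAdj λ q≤p → ≤-pred (prodApply-bounded (words-bounded u∈) (s≤s q≤p))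
  appended : count (R ∘ (_++ [ p ])) (filter (moves? p) (words p)) ≡ count (moves? p) (words p)
  appended = count-all (R ∘ (_++ [ p ])) (All.tabulate λ u∈f →
    RecordAt-append-last (words-bounded (proj₁ (∈-filter⁻ (moves? p) u∈f))))

-- Linear recurrences and Fibonacci numbers

Recurrent : (ℕ → ℤ) → Set
Recurrent a = ∀ n → a (suc (suc n)) ≡ + 3 * a (suc n) - a n

Recurrent-unique : ∀ {a b} → Recurrent a → Recurrent b → a 0 ≡ b 0 → a 1 ≡ b 1 → ∀ n → a n ≡ b n
Recurrent-unique ra rb a₀≡b₀ a₁≡b₁ zero       = a₀≡b₀
Recurrent-unique ra rb a₀≡b₀ a₁≡b₁ (suc zero) = a₁≡b₁
Recurrent-unique {a} {b} ra rb a₀≡b₀ a₁≡b₁ (suc (suc n)) = begin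
  a (suc (suc n))       ≡⟨ ra n ⟩
  + 3 * a (suc n) - a n ≡⟨ cong₂ (λ x y → + 3 * x - y) (same (suc n)) (same n) ⟩
  + 3 * b (suc n) - b n ≡⟨ rb n ⟨
  b (suc (suc n))       ∎
  where
  same : ∀ n → a n ≡ b n
  same = Recurrent-unique {a} {b} ra rb a₀≡b₀ a₁≡b₁

Recurrent-linear : ∀ {a b} c → Recurrent a → Recurrent b → Recurrent (λ n → a n - c * b n)
Recurrent-linear {a} {b} c ra rb n = begin
  a (suc (suc n)) - c * b (suc (suc n))                 ≡⟨ cong₂ (λ x y → x - c * y) (ra n) (rb n) ⟩
  (+ 3 * a (suc n) - a n) - c * (+ 3 * b (suc n) - b n) ≡⟨ identity c (a n) (a (suc n)) (b n) (b (suc n)) ⟩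
  + 3 * (a (suc n) - c * b (suc n)) - (a n - c * b n)   ∎
  where
  identity : ∀ c a₀ a₁ b₀ b₁ →
    (+ 3 * a₁ - a₀) - c * (+ 3 * b₁ - b₀) ≡ + 3 * (a₁ - c * b₁) - (a₀ - c * b₀)
  identity = solve-∀

fibℤ-rec : ∀ z → fibℤ (+ 2 + z) ≡ fibℤ (+ 1 + z) + fibℤ z
fibℤ-rec (+ n)              = refl
fibℤ-rec -[1+ 0 ]           = refl
fibℤ-rec -[1+ 1 ]           = refl
fibℤ-rec -[1+ suc (suc m) ] = alternating (signPow m) (+ fib (suc m)) (+ fib m)
  where
  alternating : ∀ s a b → s * a ≡ - s * (a + b) + - - s * (a + b + a)
  alternating = solve-∀

fibℤ-skip : ∀ w → fibℤ (+ 4 + w) ≡ + 3 * fibℤ (+ 2 + w) - fibℤ w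
fibℤ-skip w = begin
  fibℤ (+ 4 + w)                   ≡⟨ cong fibℤ (+-assoc (+ 2) (+ 2) w) ⟩
  fibℤ (+ 2 + (+ 2 + w))           ≡⟨ fibℤ-rec (+ 2 + w) ⟩
  fibℤ (+ 1 + (+ 2 + w)) + F₂      ≡⟨ cong (λ x → fibℤ x + F₂) (trans (sym (+-assoc (+ 1) (+ 2) w))
                                                                       (+-assoc (+ 2) (+ 1) w)) ⟩
  fibℤ (+ 2 + (+ 1 + w)) + F₂      ≡⟨ cong (_+ F₂) (fibℤ-rec (+ 1 + w)) ⟩
  fibℤ (+ 1 + (+ 1 + w)) + F₁ + F₂ ≡⟨ cong (λ x → fibℤ x + F₁ + F₂) (+-assoc (+ 1) (+ 1) w) ⟨
  F₂ + F₁ + F₂                     ≡⟨ cong (λ x → x + F₁ + x) (fibℤ-rec w) ⟩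
  (F₁ + F₀) + F₁ + (F₁ + F₀)       ≡⟨ identity F₁ F₀ ⟩
  + 3 * (F₁ + F₀) - F₀             ≡⟨ cong (λ x → + 3 * x - F₀) (fibℤ-rec w) ⟨
  + 3 * F₂ - F₀                    ∎
  where
  F₀ F₁ F₂ : ℤ
  F₀ = fibℤ w
  F₁ = fibℤ (+ 1 + w)
  F₂ = fibℤ (+ 2 + w)
  identity : ∀ a b → (a + b) + a + (a + b) ≡ + 3 * (a + b) - b
  identity = solve-∀

fibℤ-down : ∀ z → fibℤ z ≡ fibℤ (z - + 1) + fibℤ (z - + 2)
fibℤ-down z = begin
  fibℤ z                                  ≡⟨ cong fibℤ (shift₂ z) ⟩
  fibℤ (+ 2 + (z - + 2))                  ≡⟨ fibℤ-rec (z - + 2) ⟩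
  fibℤ (+ 1 + (z - + 2)) + fibℤ (z - + 2) ≡⟨ cong (λ x → fibℤ x + fibℤ (z - + 2)) (shift₁ z) ⟩
  fibℤ (z - + 1) + fibℤ (z - + 2)         ∎
  where
  shift₂ : ∀ z → z ≡ + 2 + (z - + 2)
  shift₂ = solve-∀
  shift₁ : ∀ z → + 1 + (z - + 2) ≡ z - + 1
  shift₁ = solve-∀

evenFib : ℤ → ℕ → ℤ
evenFib w d = fibℤ (+ 2 * + d + w)

evenFib-recurrent : ∀ w → Recurrent (evenFib w)
evenFib-recurrent w d = begin
  fibℤ (+ 2 * + suc (suc d) + w)                  ≡⟨ cong fibℤ (shift₄ (+ d) w) ⟩
  fibℤ (+ 4 + evenFibIndex)                       ≡⟨ fibℤ-skip evenFibIndex ⟩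
  + 3 * fibℤ (+ 2 + evenFibIndex) - fibℤ evenFibIndex
    ≡⟨ cong (λ x → + 3 * fibℤ x - fibℤ evenFibIndex) (shift₂ (+ d) w) ⟨
  + 3 * fibℤ (+ 2 * + suc d + w) - fibℤ evenFibIndex ∎
  where
  evenFibIndex : ℤ
  evenFibIndex = + 2 * + d + w
  shift₄ : ∀ d w → + 2 * (+ 2 + d) + w ≡ + 4 + (+ 2 * d + w)
  shift₄ = solve-∀
  shift₂ : ∀ d w → + 2 * (+ 1 + d) + w ≡ + 2 + (+ 2 * d + w)
  shift₂ = solve-∀

-- F_{z+2d} − F_{z−2} F_{2d−1}: the formula of the theorem with z = 2j − 2 and d = n − j.
closedForm : ℤ → ℕ → ℤ
closedForm z d = evenFib z d - fibℤ (z - + 2) * evenFib (- + 1) d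

closedForm-recurrent : ∀ z → Recurrent (closedForm z)
closedForm-recurrent z =
  Recurrent-linear {evenFib z} {evenFib (- + 1)} (fibℤ (z - + 2)) (evenFib-recurrent z) (evenFib-recurrent (- + 1))

closedForm-zero : ∀ z → closedForm z 0 ≡ fibℤ (z - + 1)
closedForm-zero z = begin
  fibℤ (+ 0 + z) - fibℤ (z - + 2) * + 1
    ≡⟨ cong (λ x → fibℤ x - fibℤ (z - + 2) * + 1) (+-identityˡ z) ⟩
  fibℤ z - fibℤ (z - + 2) * + 1
    ≡⟨ cong (λ x → x - fibℤ (z - + 2) * + 1) (fibℤ-down z) ⟩
  fibℤ (z - + 1) + fibℤ (z - + 2) - fibℤ (z - + 2) * + 1
    ≡⟨ identity (fibℤ (z - + 1)) (fibℤ (z - + 2)) ⟩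
  fibℤ (z - + 1)
    ∎
  where
  identity : ∀ a b → a + b - b * + 1 ≡ a
  identity = solve-∀

closedForm-one : ∀ z → closedForm z 1 ≡ fibℤ (z - + 1) + fibℤ (z + + 1)
closedForm-one z = begin
  fibℤ (+ 2 + z) - fibℤ (z - + 2) * + 1
    ≡⟨ cong (λ x → x - fibℤ (z - + 2) * + 1) (fibℤ-rec z) ⟩
  fibℤ (+ 1 + z) + fibℤ z - fibℤ (z - + 2) * + 1
    ≡⟨ cong₂ (λ x y → fibℤ x + y - fibℤ (z - + 2) * + 1) (+-comm (+ 1) z) (fibℤ-down z) ⟩
  fibℤ (z + + 1) + (fibℤ (z - + 1) + fibℤ (z - + 2)) - fibℤ (z - + 2) * + 1
    ≡⟨ identity (fibℤ (z + + 1)) (fibℤ (z - + 1)) (fibℤ (z - + 2)) ⟩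
  fibℤ (z - + 1) + fibℤ (z + + 1)
    ∎
  where
  identity : ∀ a b c → a + (b + c) - c * + 1 ≡ b + a
  identity = solve-∀

-- Closed forms of the counts

length-words : ∀ k → + length (words k) ≡ evenFib (+ 1) k
length-words = Recurrent-unique lengths-recurrent (evenFib-recurrent (+ 1)) refl refl
  where
  lengths-recurrent : Recurrent (λ k → + length (words k))
  lengths-recurrent k = begin
    + length (words (suc (suc k)))   ≡⟨ cong +_ (count-length (words (suc (suc k)))) ⟨
    + count U? (words (suc (suc k))) ≡⟨ count-words-recurrence U? k (λ _ → mk⇔ id id , mk⇔ id id) ⟩
    + 3 * + count U? (words (suc k)) - + count U? (words k)
      ≡⟨ cong₂ (λ x y → + 3 * + x - + y) (count-length (words (suc k))) (count-length (words k)) ⟩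
    + 3 * + length (words (suc k)) - + length (words k) ∎

lastRecords : ∀ p → + count (recordAt? p) (words p) ≡ fibℤ (+ 2 * + p - + 1)
lastRecords zero    = refl
lastRecords (suc k) = begin
  + count (recordAt? (suc k)) (words (suc k)) ≡⟨ cong +_ (lastRecords-suc k) ⟩
  + length (words k)                          ≡⟨ length-words k ⟩
  fibℤ (+ 2 * + k + + 1)                      ≡⟨ cong fibℤ (index (+ k)) ⟩
  fibℤ (+ 2 * + suc k - + 1)                  ∎
  where
  index : ∀ k → + 2 * k + + 1 ≡ + 2 * (+ 1 + k) - + 1
  index = solve-∀

recordCount : ℕ → ℕ → ℕ
recordCount p d = count (recordAt? p) (words (d ℕ.+ p))

recordCount-recurrent : ∀ p → Recurrent (λ d → + recordCount p d)
recordCount-recurrent p d = count-words-recurrence (recordAt? p) (d ℕ.+ p) λ {u} u∈ →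
  RecordAt-swapAdj (early-values u∈) , RecordAt-append {u} (s≤s p≤d+p)
  where
  p≤d+p : p ≤ d ℕ.+ p
  p≤d+p = m≤n+m p d
  early-values : ∀ {u} → u ∈ words (suc (d ℕ.+ p)) → ∀ {q} → q ≤ p → prodApply u q ≤ suc (d ℕ.+ p)
  early-values u∈ q≤p =
    ≤-pred (prodApply-bounded (words-bounded u∈) (s≤s (≤-trans q≤p (m≤n⇒m≤1+n p≤d+p))))

recordCount≡closedForm : ∀ p d → + recordCount p d ≡ closedForm (+ 2 * + p) d
recordCount≡closedForm p =
  Recurrent-unique (recordCount-recurrent p) (closedForm-recurrent (+ 2 * + p)) initial₀ initial₁
  where
  initial₀ : + recordCount p 0 ≡ closedForm (+ 2 * + p) 0
  initial₀ = trans (lastRecords p) (sym (closedForm-zero (+ 2 * + p)))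
  initial₁ : + recordCount p 1 ≡ closedForm (+ 2 * + p) 1
  initial₁ = begin
    + count (recordAt? p) (words (suc p))                ≡⟨ cong +_ (nextRecords p) ⟩
    + count (recordAt? p) (words p) + + length (words p) ≡⟨ cong₂ _+_ (lastRecords p) (length-words p) ⟩
    fibℤ (+ 2 * + p - + 1) + fibℤ (+ 2 * + p + + 1)      ≡⟨ closedForm-one (+ 2 * + p) ⟨
    closedForm (+ 2 * + p) 1                             ∎

recordCount-CountIs : ∀ p d → CountIs (suc (d ℕ.+ p)) (suc p) (recordCount p d)
recordCount-CountIs p d = map (oneLine N) R , unique , (λ w → listed , complete) , length-map (oneLine N) R
  where
  N : ℕ
  N = suc (d ℕ.+ p)
  R : List (List ℕ)
  R = filter (recordAt? p) (words (d ℕ.+ p))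
  p<N : p < N
  p<N = s≤s (m≤n+m p d)
  unique : Unique (map (oneLine N) R)
  unique = AllPairs.map⁺ (AllPairs.filter⁺ (recordAt? p)
    (AllPairs.map (λ {u} {v} distinct eq → distinct (oneLine-agree {u = u} {v} eq)) (words-distinct (d ℕ.+ p))))
  listed : ∀ {w} → w ∈ map (oneLine N) R → IsBoolean N w × IsRecord w (suc p)
  listed w∈
    with u , u∈R , refl ← ∈-map⁻ (oneLine N) w∈
    with u∈ , largest ← ∈-filter⁻ (recordAt? p) u∈R
    with uniq , bnd ← words-sound {d ℕ.+ p} u∈ =
    (u , uniq , bnd , refl) , from (IsRecord⇔RecordAt {u = u} p<N) largest
  complete : ∀ {w} → IsBoolean N w × IsRecord w (suc p) → w ∈ map (oneLine N) R
  complete ((is , uniq , bnd , refl) , isRecord) with u , u∈ , is≗u ← words-complete (d ℕ.+ p) uniq bnd =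
    subst (_∈ map (oneLine N) R) (sym (map-cong is≗u (upTo N)))
      (∈-map⁺ (oneLine N) (∈-filter⁺ (recordAt? p) u∈
        (RecordAt-cong (λ {q} _ → is≗u q) (to (IsRecord⇔RecordAt {u = is} p<N) isRecord))))

fibFormula : ℤ → ℤ → ℤ
fibFormula n j = fibℤ (+ 2 * n - + 2) - fibℤ (+ 2 * j - + 4) * fibℤ (+ 2 * (n - j) - + 1)

fibFormula≡closedForm : ∀ p d → fibFormula (+ suc (d ℕ.+ p)) (+ suc p) ≡ closedForm (+ 2 * + p) d
fibFormula≡closedForm p d = begin
  fibFormula (+ 1 + + (d ℕ.+ p)) (+ 1 + + p) ≡⟨ cong (λ n → fibFormula (+ 1 + n) (+ 1 + + p)) (pos-+ d p) ⟩
  fibFormula (+ 1 + (+ d + + p)) (+ 1 + + p) ≡⟨ reindex (+ d) (+ p) ⟩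
  closedForm (+ 2 * + p) d                   ∎
  where
  reindex : ∀ D P → fibFormula (+ 1 + (D + P)) (+ 1 + P) ≡
    fibℤ (+ 2 * D + + 2 * P) - fibℤ (+ 2 * P - + 2) * fibℤ (+ 2 * D + - + 1)
  reindex D P =
    cong₂ (λ x y → fibℤ x - y) (i₁ D P) (cong₂ (λ x y → fibℤ x * fibℤ y) (i₂ P) (i₃ D P))
    where
    i₁ : ∀ D P → + 2 * (+ 1 + (D + P)) - + 2 ≡ + 2 * D + + 2 * P
    i₁ = solve-∀
    i₂ : ∀ P → + 2 * (+ 1 + P) - + 4 ≡ + 2 * P - + 2
    i₂ = solve-∀
    i₃ : ∀ D P → + 2 * ((+ 1 + (D + P)) - (+ 1 + P)) - + 1 ≡ + 2 * D + - + 1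
    i₃ = solve-∀

theorem5p10 : (n j : ℕ) → 1 ≤ n → 1 ≤ j → j ≤ n →
    Σ ℕ λ c → CountIs n j c ×
    + c ≡ fibℤ (+ 2 * + n - + 2)
    - fibℤ (+ 2 * + j - + 4) * fibℤ (+ 2 * (+ n - + j) - + 1)
theorem5p10 _ zero _ () _
theorem5p10 (suc m) (suc p) _ _ (s≤s p≤m) with d ← m ∸ p | refl ← m∸n+n≡m p≤m =
  recordCount p d , recordCount-CountIs p d ,
  trans (recordCount≡closedForm p d) (sym (fibFormula≡closedForm p d))
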